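{- Let $G$ be a finite simple graph with exactly $k$ isolated vertices. Then $Z(G)\leq Z(L(G))+k$.
   Context: For a finite simple graph $H$: colour each vertex black or white. A black vertex $v$ may force a white neighbour $w$ to become black if $w$ is the only white neighbour of $v$. A set $S\subseteq V(H)$ is a zero-forcing set if, colouring exactly the vertices of $S$ black and repeatedly applying this rule, all vertices eventually become black. The zero-forcing number $Z(H)$ is the minimum size of a zero-forcing set (and $Z$ of the graph with no vertices is $0$). $L(G)$ denotes the line graph of $G$: its vertices are the edges of $G$, two being adjacent iff they share an endpoint in $G$. -}

module Defs where

open import Data.Nat using (ℕ; _+_; _≤_)
open import Data.Fin using (Fin; _<_)
open import Data.Fin.Properties using (_≟_; _<?_)
open import Data.Fin.Subset using (Subset; _∈_; _∉_; ⊤; ∣_∣; inside)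
open import Data.Vec using (_[_]≔_)
open import Data.List using (List; filter; cartesianProduct; allFin; length; lookup)
open import Data.Product using (_×_; _,_; proj₁; proj₂; ∃; ∃₂; Σ)
open import Data.Sum using (_⊎_; inj₁; inj₂)
open import Data.Empty using (⊥)
open import Relation.Nullary using (¬_; Dec; yes; no)
open import Relation.Nullary.Decidable using (_×-dec_; _⊎-dec_; ¬?)
open import Relation.Binary using (Rel; Decidable)
open import Relation.Binary.PropositionalEquality using (_≡_; _≢_; refl; sym)
open import Relation.Binary.Construct.Closure.ReflexiveTransitive using (Star)

record Graph : Set₁ where
  field
    n      : ℕ
    Adj    : Fin n → Fin n → Set
    adj?   : Decidable Adj
    adj-sym : ∀ {u v} → Adj u v → Adj v u
    adj-irrefl : ∀ {v} → ¬ Adj v v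
open Graph public

module _ (H : Graph) where
  private
    V = Fin (n H)

  data ForceStep : Subset (n H) → Subset (n H) → Set where
    force : ∀ {B} (v w : V) → v ∈ B → w ∉ B → Adj H v w →
            (∀ u → Adj H v u → u ≢ w → u ∈ B) →
            ForceStep B (B [ w ]≔ inside)

  IsZeroForcingSet : Subset (n H) → Set
  IsZeroForcingSet S = Star ForceStep S ⊤

  IsZeroForcingNumber : ℕ → Set
  IsZeroForcingNumber z =
    (Σ (Subset (n H)) λ S → IsZeroForcingSet S × ∣ S ∣ ≡ z) ×
    (∀ S → IsZeroForcingSet S → z ≤ ∣ S ∣)

  Isolated : V → Set
  Isolated v = ∀ u → ¬ Adj H v u

edges : (G : Graph) → List (Fin (n G) × Fin (n G))
edges G = filter (λ p → (proj₁ p <? proj₂ p) ×-dec adj? G (proj₁ p) (proj₂ p))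
                 (cartesianProduct (allFin (n G)) (allFin (n G)))

module _ (G : Graph) where
  private
    m = length (edges G)
    ed : Fin m → Fin (n G) × Fin (n G)
    ed = lookup (edges G)

  ShareEnd : Fin (n G) × Fin (n G) → Fin (n G) × Fin (n G) → Set
  ShareEnd (a , b) (c , d) = (a ≡ c ⊎ a ≡ d) ⊎ (b ≡ c ⊎ b ≡ d)

  shareEnd? : ∀ p q → Dec (ShareEnd p q)
  shareEnd? (a , b) (c , d) = ((a ≟ c) ⊎-dec (a ≟ d)) ⊎-dec ((b ≟ c) ⊎-dec (b ≟ d))

  shareEnd-sym : ∀ p q → ShareEnd p q → ShareEnd q p
  shareEnd-sym (a , b) (c , d) (inj₁ (inj₁ e)) = inj₁ (inj₁ (sym e))
  shareEnd-sym (a , b) (c , d) (inj₁ (inj₂ e)) = inj₂ (inj₁ (sym e))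
  shareEnd-sym (a , b) (c , d) (inj₂ (inj₁ e)) = inj₁ (inj₂ (sym e))
  shareEnd-sym (a , b) (c , d) (inj₂ (inj₂ e)) = inj₂ (inj₂ (sym e))

  LAdj : Fin m → Fin m → Set
  LAdj e f = e ≢ f × ShareEnd (ed e) (ed f)

  LineGraph : Graph
  LineGraph = record
    { n      = m
    ; Adj    = LAdj
    ; adj?   = λ e f → ¬? (e ≟ f) ×-dec shareEnd? (ed e) (ed f)
    ; adj-sym = λ { {e} {f} (ne , s) → (λ eq → ne (sym eq)) , shareEnd-sym (ed e) (ed f) s }
    ; adj-irrefl = λ { (ne , _) → ne refl }
    }

-- Fix a zero-forcing set F of L(G) with a chronology of forces; the pivot of a force is the common
-- endpoint of the forcing and the forced edge. In every component of the spanning subgraph with edge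
-- set F keep as root a vertex that is the earliest to become a pivot; the at most |F| other vertices,
-- with the isolated ones, form S. A set meeting every nonempty fort is zero forcing, and S does: if a
-- fort X avoided S, it would consist of non-isolated roots, and following the chronology no forced
-- edge is ever incident to X, so every edge at X lies in F; but then the fort property joins two roots
-- of X by at most two edges of F.

module Submission where

open import Defs
open import Data.Nat using (ℕ; suc; _+_; _≤_; _<_; z≤n; s≤s; _≤?_)
open import Data.Nat.Properties using (+-identityʳ; m≤n⇒m≤1+n; m+1+n≰m; +-suc; ≤-refl; ≤-trans; ≤-reflexive; <⇒≤; ≰⇒>; +-monoʳ-≤; +-monoˡ-≤; +-comm; n≤1+n; m≤m+n; module ≤-Reasoning)
open import Data.Bool using (true; false)
open import Data.Vec using ([]; _∷_; here; there; _[_]≔_)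
open import Data.Vec.Properties using ([]≔-updates; []≔-minimal; lookup∘update′; []=⇒lookup; lookup⇒[]=)
open import Data.Fin using (Fin; zero; suc; toℕ)
open import Data.Fin.Properties using (_≟_; _<?_; any?; all?; <-cmp)
open import Data.Fin.Subset using (Subset; _∈_; _∉_; ∣_∣; inside; ⊤; ⊥; ∁; _∪_; ⁅_⁆; _⊆_; _⊂_; _⊃_)
open import Data.Fin.Subset.Properties using (_∈?_; ∈⊤; ⊆⊤; ⊆-refl; ⊆-antisym; ∣⊥∣≡0; ∣⁅x⁆∣≡1; x∈⁅x⁆; x∈p∪q⁺; p⊆p∪q; q⊆p∪q; x∈∁p⇒x∉p; x∉p⇒x∈∁p; x∉∁p⇒x∈p)
open import Data.Fin.Subset.Induction using (Acc; acc; ⊃-wellFounded)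
open import Data.List using (length; lookup; allFin; cartesianProduct)
open import Data.List.Membership.Propositional using () renaming (_∈_ to _∈ₗ_)
open import Data.List.Membership.Propositional.Properties using (∈-filter⁺; ∈-filter⁻; ∈-cartesianProduct⁺; ∈-allFin; ∈-lookup)
open import Data.List.Relation.Unary.Any using (index)
open import Data.List.Relation.Unary.Any.Properties using (lookup-index)
open import Data.Product using (_×_; _,_; proj₁; proj₂; Σ; ∃)
open import Data.Sum using (_⊎_; inj₁; inj₂)
open import Data.Empty using (⊥-elim) renaming (⊥ to Empty)
open import Function.Bundles using (_⇔_; Equivalence)
open import Relation.Binary using (tri<; tri≈; tri>)
open import Relation.Binary.Construct.Closure.ReflexiveTransitive using (Star; ε; _◅_)
open import Relation.Binary.PropositionalEquality using (_≡_; _≢_; refl; sym; trans; cong; cong₂; subst)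
open import Relation.Nullary using (¬_; Dec; yes; no)
open import Relation.Nullary.Decidable using (_×-dec_; _⊎-dec_; _→-dec_; ¬?)

∣p∪q∣≤∣p∣+∣q∣ : ∀ {n} (p q : Subset n) → ∣ p ∪ q ∣ ≤ ∣ p ∣ + ∣ q ∣
∣p∪q∣≤∣p∣+∣q∣ []          []          = z≤n
∣p∪q∣≤∣p∣+∣q∣ (true ∷ p)  (true ∷ q)  = s≤s (≤-trans (∣p∪q∣≤∣p∣+∣q∣ p q) (+-monoʳ-≤ ∣ p ∣ (n≤1+n ∣ q ∣)))
∣p∪q∣≤∣p∣+∣q∣ (true ∷ p)  (false ∷ q) = s≤s (∣p∪q∣≤∣p∣+∣q∣ p q)
∣p∪q∣≤∣p∣+∣q∣ (false ∷ p) (true ∷ q)  = ≤-trans (s≤s (∣p∪q∣≤∣p∣+∣q∣ p q)) (≤-reflexive (sym (+-suc ∣ p ∣ ∣ q ∣)))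
∣p∪q∣≤∣p∣+∣q∣ (false ∷ p) (false ∷ q) = ∣p∪q∣≤∣p∣+∣q∣ p q

p⊆p[x]≔inside : ∀ {n} (p : Subset n) x → p ⊆ p [ x ]≔ inside
p⊆p[x]≔inside p x {y} y∈p with y ≟ x
... | yes refl = []≔-updates p x
... | no y≢x   = []≔-minimal p y x y≢x y∈p

p⊂p[x]≔inside : ∀ {n} (p : Subset n) {x} → x ∉ p → p ⊂ p [ x ]≔ inside
p⊂p[x]≔inside p {x} x∉p = p⊆p[x]≔inside p x , x , []≔-updates p x , x∉p

y∈p[x]≔inside⇒y∈p : ∀ {n} (p : Subset n) {x y} → y ∈ p [ x ]≔ inside → y ≢ x → y ∈ p
y∈p[x]≔inside⇒y∈p p {y = y} y∈ y≢x = lookup⇒[]= y p (trans (sym (lookup∘update′ y≢x p inside)) ([]=⇒lookup y∈))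

module _ (H : Graph) where

  IsFort : Subset (n H) → Set
  IsFort X = ∀ {y c} → y ∉ X → c ∈ X → Adj H y c → Σ (Fin (n H)) λ x → x ∈ X × x ≢ c × Adj H y x

  private
    CanForce : Subset (n H) → Fin (n H) → Fin (n H) → Set
    CanForce B v w = v ∈ B × w ∉ B × Adj H v w × (∀ u → Adj H v u → u ≢ w → u ∈ B)

    canForce? : ∀ B v w → Dec (CanForce B v w)
    canForce? B v w = v ∈? B ×-dec ¬? (w ∈? B) ×-dec adj? H v w ×-dec
                      all? (λ u → adj? H v u →-dec ¬? (u ≟ w) →-dec u ∈? B)

    stuck⇒fort : ∀ B → ¬ (∃ λ v → ∃ λ w → CanForce B v w) → IsFort (∁ B)
    stuck⇒fort B stuck {y} {c} y∉∁B c∈∁B yc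
      with any? (λ u → adj? H y u ×-dec (¬? (u ≟ c) ×-dec ¬? (u ∈? B)))
    ... | yes (u , yu , u≢c , u∉B) = u , x∉p⇒x∈∁p u∉B , u≢c , yu
    ... | no none = ⊥-elim (stuck (y , c , x∉∁p⇒x∈p y∉∁B , x∈∁p⇒x∉p c∈∁B , yc , othersBlack))
      where
      othersBlack : ∀ u → Adj H y u → u ≢ c → u ∈ B
      othersBlack u yu u≢c with u ∈? B
      ... | yes u∈B = u∈B
      ... | no u∉B = ⊥-elim (none (u , yu , u≢c , u∉B))

  meetsEveryFort⇒zeroForcing : ∀ S → (∀ X {x} → x ∈ X → IsFort X → ¬ (∀ z → z ∈ X → z ∉ S)) →
                               IsZeroForcingSet H S
  meetsEveryFort⇒zeroForcing S meets = close S (⊃-wellFounded S) ⊆-refl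
    where
    close : ∀ B → Acc _⊃_ B → S ⊆ B → Star (ForceStep H) B ⊤
    close B (acc rec) S⊆B with any? (λ w → ¬? (w ∈? B))
    ... | no full = subst (λ C → Star (ForceStep H) C ⊤) (⊆-antisym black ⊆⊤) ε
      where
      black : ⊤ ⊆ B
      black {x} _ with x ∈? B
      ... | yes x∈B = x∈B
      ... | no x∉B = ⊥-elim (full (x , x∉B))
    ... | yes (w , w∉B) with any? (λ v → any? (λ u → canForce? B v u))
    ...   | yes (v , u , v∈B , u∉B , vu , othersBlack) =
            force v u v∈B u∉B vu othersBlack ◅ close _ (rec (p⊂p[x]≔inside B u∉B)) (λ s → p⊆p[x]≔inside B u (S⊆B s))
    ...   | no stuck = ⊥-elim (meets (∁ B) (x∉p⇒x∈∁p w∉B) (stuck⇒fort B stuck) λ z z∈∁B z∈S → x∈∁p⇒x∉p z∈∁B (S⊆B z∈S))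

module KeyedRoots {N : ℕ} (key : Fin N → ℕ) where

  -- Union–find over the pairs (a i , b i), i ∈ F, each union keeping the root of smaller key.
  record RootAssignment {k} (F : Subset k) (a b : Fin k → Fin N) : Set where
    field
      root           : Fin N → Fin N
      nonRoots       : Subset N
      root-fixed     : ∀ x → x ∉ nonRoots → root x ≡ x
      key-root≤      : ∀ x → key (root x) ≤ key x
      root-joins     : ∀ i → i ∈ F → root (a i) ≡ root (b i)
      ∣nonRoots∣≤∣F∣ : ∣ nonRoots ∣ ≤ ∣ F ∣
  open RootAssignment

  redirect : (Fin N → Fin N) → Fin N → Fin N → Fin N → Fin N
  redirect ρ l w x with ρ x ≟ l
  ... | yes _ = w
  ... | no _  = ρ x

  module _ (ρ : Fin N → Fin N) (l w : Fin N) where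

    redirect-cong : ∀ {x y} → ρ x ≡ ρ y → redirect ρ l w x ≡ redirect ρ l w y
    redirect-cong {x} {y} ρx≡ρy with ρ x ≟ l | ρ y ≟ l
    ... | yes _    | yes _    = refl
    ... | no _     | no _     = ρx≡ρy
    ... | yes ρx≡l | no ρy≢l  = ⊥-elim (ρy≢l (trans (sym ρx≡ρy) ρx≡l))
    ... | no ρx≢l  | yes ρy≡l = ⊥-elim (ρx≢l (trans ρx≡ρy ρy≡l))

    redirect-onto : ∀ {x} → ρ x ≡ l ⊎ ρ x ≡ w → redirect ρ l w x ≡ w
    redirect-onto {x} ρx∈ with ρ x ≟ l
    ... | yes _    = refl
    ... | no ρx≢l with ρx∈
    ...   | inj₁ ρx≡l = ⊥-elim (ρx≢l ρx≡l)
    ...   | inj₂ ρx≡w = ρx≡w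

  joinRoots : ∀ {k} {F : Subset k} {a b : Fin (suc k) → Fin N} →
              (r : RootAssignment F (λ i → a (suc i)) (λ i → b (suc i))) (l w : Fin N) → key w ≤ key l →
              root r (a zero) ≡ l ⊎ root r (a zero) ≡ w → root r (b zero) ≡ l ⊎ root r (b zero) ≡ w →
              RootAssignment (true ∷ F) a b
  joinRoots {F = F} {a} {b} r l w w≤l a₀∈ b₀∈ = record
    { root           = redirect ρ l w
    ; nonRoots       = nonRoots r ∪ ⁅ l ⁆
    ; root-fixed     = fixed
    ; key-root≤      = keyDecreases
    ; root-joins     = joins
    ; ∣nonRoots∣≤∣F∣ = begin
        ∣ nonRoots r ∪ ⁅ l ⁆ ∣     ≤⟨ ∣p∪q∣≤∣p∣+∣q∣ (nonRoots r) ⁅ l ⁆ ⟩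
        ∣ nonRoots r ∣ + ∣ ⁅ l ⁆ ∣ ≡⟨ cong (∣ nonRoots r ∣ +_) (∣⁅x⁆∣≡1 l) ⟩
        ∣ nonRoots r ∣ + 1         ≡⟨ +-comm ∣ nonRoots r ∣ 1 ⟩
        suc ∣ nonRoots r ∣         ≤⟨ s≤s (∣nonRoots∣≤∣F∣ r) ⟩
        suc ∣ F ∣                  ∎
    }
    where
    open ≤-Reasoning
    ρ = root r

    fixed : ∀ x → x ∉ nonRoots r ∪ ⁅ l ⁆ → redirect ρ l w x ≡ x
    fixed x x∉ with ρ x ≟ l
    ... | yes ρx≡l = ⊥-elim (x∉ (x∈p∪q⁺ (inj₂ (subst (_∈ ⁅ l ⁆) (sym x≡l) (x∈⁅x⁆ l)))))
      where
      x≡l : x ≡ l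
      x≡l = trans (sym (root-fixed r x λ x∈ → x∉ (x∈p∪q⁺ (inj₁ x∈)))) ρx≡l
    ... | no _ = root-fixed r x λ x∈ → x∉ (x∈p∪q⁺ (inj₁ x∈))

    keyDecreases : ∀ x → key (redirect ρ l w x) ≤ key x
    keyDecreases x with ρ x ≟ l
    ... | yes ρx≡l = ≤-trans w≤l (subst (λ y → key y ≤ key x) ρx≡l (key-root≤ r x))
    ... | no _     = key-root≤ r x

    joins : ∀ i → i ∈ true ∷ F → redirect ρ l w (a i) ≡ redirect ρ l w (b i)
    joins zero    here      = trans (redirect-onto ρ l w a₀∈) (sym (redirect-onto ρ l w b₀∈))
    joins (suc i) (there i∈F) = redirect-cong ρ l w (root-joins r i i∈F)

  assignRoots : ∀ {k} (F : Subset k) (a b : Fin k → Fin N) → RootAssignment F a b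
  assignRoots [] a b = record
    { root = λ x → x ; nonRoots = ⊥ ; root-fixed = λ _ _ → refl ; key-root≤ = λ _ → ≤-refl
    ; root-joins = λ _ () ; ∣nonRoots∣≤∣F∣ = ≤-reflexive (∣⊥∣≡0 N) }
  assignRoots (false ∷ F) a b = record
    { root = root r ; nonRoots = nonRoots r ; root-fixed = root-fixed r ; key-root≤ = key-root≤ r
    ; root-joins = λ { (suc i) (there i∈F) → root-joins r i i∈F } ; ∣nonRoots∣≤∣F∣ = ∣nonRoots∣≤∣F∣ r }
    where r = assignRoots F (λ i → a (suc i)) (λ i → b (suc i))
  assignRoots (true ∷ F) a b = addPair (assignRoots F (λ i → a (suc i)) (λ i → b (suc i)))
    where
    addPair : RootAssignment F (λ i → a (suc i)) (λ i → b (suc i)) → RootAssignment (true ∷ F) a b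
    addPair r with key (root r (a zero)) ≤? key (root r (b zero))
    ... | yes a₀≤b₀ = joinRoots r (root r (b zero)) (root r (a zero)) a₀≤b₀ (inj₂ refl) (inj₁ refl)
    ... | no a₀≰b₀  = joinRoots r (root r (a zero)) (root r (b zero)) (<⇒≤ (≰⇒> a₀≰b₀)) (inj₁ refl) (inj₂ refl)

module LineGraphEdges (G : Graph) where

  ends : Fin (length (edges G)) → Fin (n G) × Fin (n G)
  ends = lookup (edges G)

  Incident : Fin (length (edges G)) → Fin (n G) → Set
  Incident e x = proj₁ (ends e) ≡ x ⊎ proj₂ (ends e) ≡ x

  incident? : ∀ e x → Dec (Incident e x)
  incident? e x = (proj₁ (ends e) ≟ x) ⊎-dec (proj₂ (ends e) ≟ x)

  private
    isEdge? : ∀ p → Dec (toℕ (proj₁ p) < toℕ (proj₂ p) × Adj G (proj₁ p) (proj₂ p))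
    isEdge? p = (proj₁ p <? proj₂ p) ×-dec adj? G (proj₁ p) (proj₂ p)

    listed : ∀ {a b} → toℕ a < toℕ b → Adj G a b → Σ (Fin (length (edges G))) λ e → ends e ≡ (a , b)
    listed {a} {b} a<b ab = index ab∈ , sym (lookup-index ab∈)
      where
      ab∈ : (a , b) ∈ₗ edges G
      ab∈ = ∈-filter⁺ isEdge? (∈-cartesianProduct⁺ (∈-allFin a) (∈-allFin b)) (a<b , ab)

  ends-adjacent : ∀ e → Adj G (proj₁ (ends e)) (proj₂ (ends e))
  ends-adjacent e = proj₂ (proj₂ (∈-filter⁻ isEdge? {xs = cartesianProduct (allFin (n G)) (allFin (n G))} (∈-lookup e)))

  edgeBetween : ∀ {a b} → Adj G a b → Σ (Fin (length (edges G))) λ e → Incident e a × Incident e b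
  edgeBetween {a} {b} ab with <-cmp a b
  ... | tri< a<b _ _ = let e , eq = listed a<b ab in e , inj₁ (cong proj₁ eq) , inj₂ (cong proj₂ eq)
  ... | tri≈ _ refl _ = ⊥-elim (adj-irrefl G ab)
  ... | tri> _ _ b<a = let e , eq = listed b<a (adj-sym G ab) in e , inj₂ (cong proj₂ eq) , inj₁ (cong proj₁ eq)

  otherEnd : ∀ {e p} → Incident e p →
             Σ (Fin (n G)) λ q → Incident e q × Adj G p q × (∀ {z} → Incident e z → z ≡ p ⊎ z ≡ q)
  otherEnd {e} (inj₁ refl) = proj₂ (ends e) , inj₂ refl , ends-adjacent e ,
                             λ { (inj₁ refl) → inj₁ refl ; (inj₂ refl) → inj₂ refl }
  otherEnd {e} (inj₂ refl) = proj₁ (ends e) , inj₁ refl , adj-sym G (ends-adjacent e) ,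
                             λ { (inj₁ refl) → inj₂ refl ; (inj₂ refl) → inj₁ refl }

  shareEnd⇒common : ∀ {e f} → ShareEnd G (ends e) (ends f) → Σ (Fin (n G)) λ x → Incident e x × Incident f x
  shareEnd⇒common (inj₁ (inj₁ eq)) = _ , inj₁ refl , inj₁ (sym eq)
  shareEnd⇒common (inj₁ (inj₂ eq)) = _ , inj₁ refl , inj₂ (sym eq)
  shareEnd⇒common (inj₂ (inj₁ eq)) = _ , inj₂ refl , inj₁ (sym eq)
  shareEnd⇒common (inj₂ (inj₂ eq)) = _ , inj₂ refl , inj₂ (sym eq)

  common⇒shareEnd : ∀ {e f x} → Incident e x → Incident f x → ShareEnd G (ends e) (ends f)
  common⇒shareEnd (inj₁ refl) (inj₁ eq) = inj₁ (inj₁ (sym eq))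
  common⇒shareEnd (inj₁ refl) (inj₂ eq) = inj₁ (inj₂ (sym eq))
  common⇒shareEnd (inj₂ refl) (inj₁ eq) = inj₂ (inj₁ (sym eq))
  common⇒shareEnd (inj₂ refl) (inj₂ eq) = inj₂ (inj₂ (sym eq))

  forced : ∀ {B B'} → ForceStep (LineGraph G) B B' → Fin (length (edges G))
  forced (force _ f _ _ _ _) = f

  IsPivot : ∀ {B B'} → ForceStep (LineGraph G) B B' → Fin (n G) → Set
  IsPivot (force e f _ _ _ _) x = Incident e x × Incident f x

  -- When x is never a pivot, this is the number of remaining forces.
  pivotTime : ∀ {B C} → Star (ForceStep (LineGraph G)) B C → Fin (n G) → ℕ
  pivotTime ε x = 0
  pivotTime (force e f _ _ _ _ ◅ rest) x with incident? e x ×-dec incident? f x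
  ... | yes _ = 0
  ... | no _  = suc (pivotTime rest x)

  pivotTime-◅ : ∀ {B B' C} (s : ForceStep (LineGraph G) B B') (rest : Star (ForceStep (LineGraph G)) B' C) x →
                (IsPivot s x × pivotTime (s ◅ rest) x ≡ 0) ⊎ pivotTime (s ◅ rest) x ≡ suc (pivotTime rest x)
  pivotTime-◅ (force e f _ _ _ _) rest x with incident? e x ×-dec incident? f x
  ... | yes pivot = inj₁ (pivot , refl)
  ... | no _      = inj₂ refl

  pivotTime-pivot : ∀ {B B' C} (s : ForceStep (LineGraph G) B B') (rest : Star (ForceStep (LineGraph G)) B' C) {x} →
                    IsPivot s x → pivotTime (s ◅ rest) x ≡ 0
  pivotTime-pivot (force e f _ _ _ _) rest {x} pivot with incident? e x ×-dec incident? f x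
  ... | yes _     = refl
  ... | no ¬pivot = ⊥-elim (¬pivot pivot)

module FortAvoidance (G : Graph) {F : Subset (length (edges G))}
                     (chronology : Star (ForceStep (LineGraph G)) F ⊤) where
  open LineGraphEdges G

  L : Graph
  L = LineGraph G

  τ : Fin (n G) → ℕ
  τ = pivotTime chronology

  -- The state after t forces, with rest the remaining forces.
  record Clock (t : ℕ) {B} (rest : Star (ForceStep L) B ⊤) : Set where
    field
      F⊆B       : F ⊆ B
      τ-bound   : ∀ x → τ x ≤ t + pivotTime rest x
      τ-pending : ∀ x → (Σ (Fin (length (edges G))) λ e → e ∈ B × e ∉ F × Incident e x)
                        ⊎ τ x ≡ t + pivotTime rest x
  open Clock

  clock-start : Clock 0 chronology
  clock-start = record { F⊆B = λ e∈F → e∈F ; τ-bound = λ _ → ≤-refl ; τ-pending = λ _ → inj₂ refl }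

  clock-step : ∀ {t B B'} (s : ForceStep L B B') (rest : Star (ForceStep L) B' ⊤) →
               Clock t (s ◅ rest) → Clock (suc t) rest
  clock-step {t} {B} s@(force _ h _ h∉B _ _) rest clock = record
    { F⊆B = λ e∈F → p⊆p[x]≔inside B h (F⊆B clock e∈F)
    ; τ-bound = bound
    ; τ-pending = pending
    }
    where
    bound : ∀ x → τ x ≤ suc t + pivotTime rest x
    bound x with pivotTime-◅ s rest x
    ... | inj₁ (_ , now) = begin
      τ x                           ≤⟨ τ-bound clock x ⟩
      t + pivotTime (s ◅ rest) x    ≡⟨ cong (t +_) now ⟩
      t + 0                         ≡⟨ +-identityʳ t ⟩
      t                             ≤⟨ m≤n⇒m≤1+n (m≤m+n t (pivotTime rest x)) ⟩
      suc t + pivotTime rest x      ∎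
      where open ≤-Reasoning
    ... | inj₂ later = subst (τ x ≤_) (trans (cong (t +_) later) (+-suc t _)) (τ-bound clock x)

    pending : ∀ x → (Σ (Fin (length (edges G))) λ e → e ∈ B [ h ]≔ inside × e ∉ F × Incident e x)
                    ⊎ τ x ≡ suc t + pivotTime rest x
    pending x with τ-pending clock x | pivotTime-◅ s rest x
    ... | inj₁ (e , e∈B , e∉F , ex) | _ = inj₁ (e , p⊆p[x]≔inside B h e∈B , e∉F , ex)
    ... | inj₂ _ | inj₁ ((_ , hx) , _) = inj₁ (h , []≔-updates B h , (λ h∈F → h∉B (F⊆B clock h∈F)) , hx)
    ... | inj₂ τx≡ | inj₂ later = inj₂ (trans τx≡ (trans (cong (t +_) later) (+-suc t _)))

  module _ (ρ : Fin (n G) → Fin (n G)) (τ-root≤ : ∀ x → τ (ρ x) ≤ τ x)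
           (root-edge : ∀ {e a b} → e ∈ F → Incident e a → Incident e b → ρ a ≡ ρ b)
           (X : Subset (n G)) (fort : IsFort G X) (X-roots : ∀ x → x ∈ X → ρ x ≡ x) where

    X-root-injective : ∀ {x y} → x ∈ X → y ∈ X → ρ x ≡ ρ y → x ≡ y
    X-root-injective {x} {y} x∈X y∈X ρx≡ρy = trans (sym (X-roots x x∈X)) (trans ρx≡ρy (X-roots y y∈X))

    EdgesAtXIn : Subset (length (edges G)) → Set
    EdgesAtXIn B = ∀ {e x} → e ∈ B → x ∈ X → Incident e x → e ∈ F

    -- A black edge g at p ∈ X would lie in F; its other end q must then leave X, and the fort
    -- gives a second X-neighbour x of q, whose edge to q is black too, so p and x get the same root.
    pivot∉X : ∀ {B g h p} → g ∈ B → (∀ u → Adj L g u → u ≢ h → u ∈ B) → EdgesAtXIn B →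
              Incident g p → Incident h p → p ∉ X
    pivot∉X {_} {g} {h} {p} g∈B othersBlack edgesAtX gp hp p∈X with otherEnd gp
    ... | q , gq , pq , g-ends with q ∈? X
    ...   | yes q∈X = adj-irrefl G (subst (Adj G p) (sym (X-root-injective p∈X q∈X (root-edge (edgesAtX g∈B p∈X gp) gp gq))) pq)
    ...   | no q∉X with fort q∉X p∈X (adj-sym G pq)
    ...     | x , x∈X , x≢p , qx with edgeBetween qx
    ...       | j , jq , jx = x≢p (X-root-injective x∈X p∈X (trans (sym (root-edge j∈F jq jx)) (root-edge g∈F gq gp)))
      where
      g∈F : g ∈ F
      g∈F = edgesAtX g∈B p∈X gp

      j≢g : j ≢ g
      j≢g refl with g-ends jx
      ... | inj₁ x≡p = x≢p x≡p
      ... | inj₂ refl = q∉X x∈X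

      j≢h : j ≢ h
      j≢h refl with otherEnd hp
      ... | r , _ , _ , h-ends with h-ends jq | h-ends jx
      ...   | inj₁ q≡p | _        = adj-irrefl G (subst (Adj G p) q≡p pq)
      ...   | _        | inj₁ x≡p = x≢p x≡p
      ...   | inj₂ q≡r | inj₂ x≡r = q∉X (subst (_∈ X) (trans x≡r (sym q≡r)) x∈X)

      j∈F : j ∈ F
      j∈F = edgesAtX (othersBlack j ((λ g≡j → j≢g (sym g≡j)) , common⇒shareEnd gq jq) j≢h) x∈X jx

    -- With pivot p ∉ X and forced edge pc, c ∈ X, the fort gives another X-neighbour x of p. The edge px is
    -- black, hence in F, so x is the root of p and τ x ≤ τ p ≤ t; yet x, carrying no black edge outside F,
    -- cannot have been a pivot before step t, and is not the pivot of step t.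
    forcedAvoidsX : ∀ {t B B'} (s : ForceStep L B B') (rest : Star (ForceStep L) B' ⊤) → Clock t (s ◅ rest) →
                    EdgesAtXIn B → ∀ {c} → c ∈ X → ¬ Incident (forced s) c
    forcedAvoidsX {t} {B} s@(force g h g∈B _ (_ , shared) othersBlack) rest clock edgesAtX {c} c∈X hc
      with shareEnd⇒common shared
    ... | p , gp , hp with p ∈? X
    ...   | yes p∈X = pivot∉X g∈B othersBlack edgesAtX gp hp p∈X
    ...   | no p∉X with otherEnd hp
    ...     | q , _ , pq , h-ends with h-ends hc
    ...       | inj₁ refl = p∉X c∈X
    ...       | inj₂ refl with fort p∉X c∈X pq
    ...         | x , x∈X , x≢c , px with edgeBetween px
    ...           | j , jp , jx = notPending (τ-pending clock x)
      where
      x∉h : ¬ Incident h x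
      x∉h hx with h-ends hx
      ... | inj₁ refl = p∉X x∈X
      ... | inj₂ refl = x≢c refl

      j∈B : j ∈ B
      j∈B with j ≟ g
      ... | yes refl = g∈B
      ... | no j≢g   = othersBlack j ((λ g≡j → j≢g (sym g≡j)) , common⇒shareEnd gp jp) λ { refl → x∉h jx }

      τx≤t : τ x ≤ t
      τx≤t = begin
        τ x                         ≡⟨ cong τ (sym (trans (root-edge (edgesAtX j∈B x∈X jx) jp jx) (X-roots x x∈X))) ⟩
        τ (ρ p)                     ≤⟨ τ-root≤ p ⟩
        τ p                         ≤⟨ τ-bound clock p ⟩
        t + pivotTime (s ◅ rest) p  ≡⟨ cong (t +_) (pivotTime-pivot s rest (gp , hp)) ⟩
        t + 0                       ≡⟨ +-identityʳ t ⟩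
        t                           ∎
        where open ≤-Reasoning

      notPending : (Σ (Fin (length (edges G))) λ e → e ∈ B × e ∉ F × Incident e x)
                   ⊎ τ x ≡ t + pivotTime (s ◅ rest) x → Empty
      notPending (inj₁ (e , e∈B , e∉F , ex)) = e∉F (edgesAtX e∈B x∈X ex)
      notPending (inj₂ τx≡) with pivotTime-◅ s rest x
      ... | inj₁ ((_ , hx) , _) = x∉h hx
      ... | inj₂ later          = m+1+n≰m t (subst (_≤ t) (trans τx≡ (cong (t +_) later)) τx≤t)

    edgesAtX⊆F : ∀ {t B} (rest : Star (ForceStep L) B ⊤) → Clock t rest → EdgesAtXIn B →
                 ∀ {e x} → x ∈ X → Incident e x → e ∈ F
    edgesAtX⊆F ε _ edgesAtX = edgesAtX ∈⊤
    edgesAtX⊆F {B = B} (s@(force _ h _ _ _ _) ◅ rest) clock edgesAtX =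
      edgesAtX⊆F rest (clock-step s rest clock) edgesAtX′
      where
      edgesAtX′ : EdgesAtXIn (B [ h ]≔ inside)
      edgesAtX′ {e} e∈B′ x∈X ex with e ≟ h
      ... | yes refl = ⊥-elim (forcedAvoidsX s rest clock edgesAtX x∈X ex)
      ... | no e≢h   = edgesAtX (y∈p[x]≔inside⇒y∈p B e∈B′ e≢h) x∈X ex

    edgesAtX⊈F : ∀ {x₀ y} → x₀ ∈ X → Adj G x₀ y → ¬ (∀ {e x} → x ∈ X → Incident e x → e ∈ F)
    edgesAtX⊈F {x₀} {y} x₀∈X x₀y inF with edgeBetween x₀y
    ... | e , ex₀ , ey with y ∈? X
    ...   | yes y∈X = adj-irrefl G (subst (Adj G x₀) (sym (X-root-injective x₀∈X y∈X (root-edge (inF x₀∈X ex₀) ex₀ ey))) x₀y)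
    ...   | no y∉X with fort y∉X x₀∈X (adj-sym G x₀y)
    ...     | x , x∈X , x≢x₀ , yx with edgeBetween yx
    ...       | j , jy , jx = x≢x₀ (X-root-injective x∈X x₀∈X (trans (root-edge (inF x∈X jx) jx jy) (root-edge (inF x₀∈X ex₀) ey ex₀)))

    X-isolated : ∀ {x₀ y} → x₀ ∈ X → ¬ Adj G x₀ y
    X-isolated x₀∈X x₀y = edgesAtX⊈F x₀∈X x₀y (edgesAtX⊆F chronology clock-start λ e∈F _ _ → e∈F)

zeroForcingSet-fromLineGraph : (G : Graph) (I : Subset (n G)) → (∀ v → v ∉ I → ∃ (Adj G v)) →
                               ∀ {F} → IsZeroForcingSet (LineGraph G) F →
                               Σ (Subset (n G)) λ S → IsZeroForcingSet G S × ∣ S ∣ ≤ ∣ F ∣ + ∣ I ∣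
zeroForcingSet-fromLineGraph G I nonIsolated {F} chronology =
  nonRoots ∪ I , meetsEveryFort⇒zeroForcing G (nonRoots ∪ I) meets ,
  ≤-trans (∣p∪q∣≤∣p∣+∣q∣ nonRoots I) (+-monoˡ-≤ ∣ I ∣ ∣nonRoots∣≤∣F∣)
  where
  open LineGraphEdges G
  open KeyedRoots (pivotTime chronology)
  open RootAssignment (assignRoots F (λ e → proj₁ (ends e)) (λ e → proj₂ (ends e)))

  root-edge : ∀ {e a b} → e ∈ F → Incident e a → Incident e b → root a ≡ root b
  root-edge e∈F (inj₁ refl) (inj₁ refl) = refl
  root-edge e∈F (inj₂ refl) (inj₂ refl) = refl
  root-edge e∈F (inj₁ refl) (inj₂ refl) = root-joins _ e∈F
  root-edge e∈F (inj₂ refl) (inj₁ refl) = sym (root-joins _ e∈F)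

  meets : ∀ X {x} → x ∈ X → IsFort G X → ¬ (∀ z → z ∈ X → z ∉ nonRoots ∪ I)
  meets X {x₀} x₀∈X fort disjoint =
    FortAvoidance.X-isolated G chronology root key-root≤ root-edge X fort X-roots x₀∈X (proj₂ neighbour)
    where
    X-roots : ∀ x → x ∈ X → root x ≡ x
    X-roots x x∈X = root-fixed x λ x∈ → disjoint x x∈X (p⊆p∪q I x∈)

    neighbour : ∃ (Adj G x₀)
    neighbour = nonIsolated x₀ λ x₀∈I → disjoint x₀ x₀∈X (q⊆p∪q nonRoots I x₀∈I)

nonIsolated-outside : (G : Graph) (I : Subset (n G)) → (∀ v → (v ∈ I) ⇔ Isolated G v) →
                      ∀ v → v ∉ I → ∃ (Adj G v)
nonIsolated-outside G I I⇔isolated v v∉I with any? (adj? G v)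
... | yes neighbour = neighbour
... | no none       = ⊥-elim (v∉I (Equivalence.from (I⇔isolated v) λ u vu → none (u , vu)))

corollary4 : (G : Graph) (k : ℕ) (I : Subset (n G)) →
    (∀ v → (v ∈ I) ⇔ Isolated G v) → ∣ I ∣ ≡ k →
    ∀ zG zL → IsZeroForcingNumber G zG → IsZeroForcingNumber (LineGraph G) zL →
    zG ≤ zL + k
corollary4 G k I I⇔isolated ∣I∣≡k zG zL (_ , minimal) ((F , F-forcing , ∣F∣≡zL) , _)
  with zeroForcingSet-fromLineGraph G I (nonIsolated-outside G I I⇔isolated) F-forcing
... | S , S-forcing , ∣S∣≤∣F∣+∣I∣ = begin
  zG             ≤⟨ minimal S S-forcing ⟩
  ∣ S ∣          ≤⟨ ∣S∣≤∣F∣+∣I∣ ⟩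
  ∣ F ∣ + ∣ I ∣  ≡⟨ cong₂ _+_ ∣F∣≡zL ∣I∣≡k ⟩
  zL + k         ∎
  where open ≤-Reasoning
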